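{- Let $G$ be a split graph with a split partition consisting of a clique $C$ and an independent set $I$, let $\pi$ be a partial order on $V(G)$ and $A\subseteq I$. Assume $(\pi,A)$ fulfills the nested property, let $\pi'=\pi^N(\pi,A)$, and let $\rho$ be a linear extension of $\pi'$. Then for every graph search $\mathcal A\in\{\mathrm{MNS},\mathrm{MCS},\mathrm{LBFS}\}$, the ordering $\sigma=\mathcal A^+(\rho)$ of $G$ satisfies: if $x\prec_{\pi'} y$, then $x\prec_\sigma y$ or both $x$ and $y$ are not in $A\cup C$.
   Context: Graphs are finite, simple, undirected, connected; $N(v)$ is the neighborhood of $v$. A split graph has a vertex partition into a clique $C$ and an independent set $I$. $x\prec_\pi y$ means $(x,y)\in\pi$, $x\ne y$. Label Search w.r.t. a strict partial order $\prec_{\mathcal A}$ on sets of positive integers: labels start empty; for $i=1,\dots,|V(G)|$ the eligible vertices are the unnumbered $x$ with no unnumbered $y$ such that $\mathrm{label}(x)\prec_{\mathcal A}\mathrm{label}(y)$; one is chosen as $\sigma(i)$ and $i$ is added to the labels of its unnumbered neighbors. MNS: $A\prec B$ iff $A\subsetneq B$; MCS: $|A|<|B|$; LBFS: $A\subsetneq B$ or $\min(A\setminus B)>\min(B\setminus A)$. $\mathcal A^+(\rho)$ always chooses the eligible vertex leftmost in $\rho$. For $A\subseteq I$, $(\pi,A)$ fulfills the nested property if: (N1) if $y\in C$ and $x\prec_\pi y$ then $x\in C\cup A$; (N2) there are pairwise disjoint sets $C_1,I_1,\dots,C_k,I_k$ with $\bigcup_{j=1}^k I_j=A$ such that for every $i$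 and every $x\in I_i$, $N(x)=\bigcup_{j=1}^i C_j$; (N3) if $y\in C_i\cup I_i$ and $x\prec_\pi y$ then $x\in C_j\cup I_j$ for some $j\le i$; (N4) for each $i$ there is at most one $x\in I_i$ for which some $y\in C_i$ satisfies $x\prec_\pi y$. The nested partial order $\pi^N(\pi,A)$ (w.r.t. the sets from (N2)) is the reflexive and transitive closure of: (P1) $(x,y)$ for all $x\prec_\pi y$; (P2) $(x,y)$ for all $x\in I_i\cup C_i$, $y\in V(G)\setminus\bigcup_{j=1}^i(I_j\cup C_j)$; (P3) $(x,y)$ for all $x\in C$, $y\in I\setminus A$; (P4) $(x,y)$ for all $x,y\in I_i$ such that some $z\in C_i$ has $x\prec_\pi z$. -}

module Defs where

open import Data.Nat using (ℕ; _<_; _≤_; _<ᵇ_)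
open import Data.Bool using (Bool; true; false; _∧_)
open import Data.Fin using (Fin; toℕ)
open import Data.Fin.Subset using (Subset; _∈_; _∉_; _⊂_; ∣_∣; _─_)
open import Data.Vec using (tabulate)
open import Data.Product using (Σ; ∃; ∃-syntax; _×_)
open import Data.Sum using (_⊎_)
open import Relation.Nullary using (¬_)
open import Relation.Binary.PropositionalEquality using (_≡_; _≢_)
open import Relation.Binary.Structures using (IsPartialOrder)
open import Relation.Binary.Construct.Closure.ReflexiveTransitive using (Star)
open import Function.Bundles using (Inverse; _↔_)

record Graph (n : ℕ) : Set where
  field
    adj       : Fin n → Fin n → Bool
    symmetric : ∀ x y → adj x y ≡ adj y x
    loopless  : ∀ x → adj x x ≡ false
    connected : ∀ x y → Star (λ u v → adj u v ≡ true) x y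

open Graph public

Adj : ∀ {n} → Graph n → Fin n → Fin n → Set
Adj G x y = adj G x y ≡ true

record IsSplitPartition {n} (G : Graph n) (C I : Subset n) : Set where
  field
    cover       : ∀ x → x ∈ C ⊎ x ∈ I
    disjoint    : ∀ x → x ∈ C → x ∉ I
    clique      : ∀ x y → x ∈ C → y ∈ C → x ≢ y → Adj G x y
    independent : ∀ x y → x ∈ I → y ∈ I → ¬ Adj G x y

Rel : ℕ → Set₁
Rel n = Fin n → Fin n → Set

IsPO : ∀ {n} → Rel n → Set
IsPO π = IsPartialOrder _≡_ π

strict : ∀ {n} → Rel n → Rel n
strict π x y = π x y × x ≢ y

-- Vertex orderings: a bijection between positions and vertices.
-- Inverse.to σ i = σ(i) (vertex at position i),
-- Inverse.from σ x = position of x.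

Ordering : ℕ → Set
Ordering n = Fin n ↔ Fin n

pos : ∀ {n} → Ordering n → Fin n → Fin n
pos σ = Inverse.from σ

at : ∀ {n} → Ordering n → Fin n → Fin n
at σ = Inverse.to σ

_≺[_]_ : ∀ {n} → Fin n → Ordering n → Fin n → Set
x ≺[ σ ] y = toℕ (pos σ x) < toℕ (pos σ y)

IsLinearExtension : ∀ {n} → Rel n → Ordering n → Set
IsLinearExtension π ρ = ∀ x y → strict π x y → x ≺[ ρ ] y

-- Nested property.  The sets C_1, I_1, ..., C_k, I_k are indexed by Fin k
-- (Cs i = C_{i+1}, Is i = I_{i+1}).

_≤ᶠ_ : ∀ {k} → Fin k → Fin k → Set
i ≤ᶠ j = toℕ i ≤ toℕ j

record Nested {n} (G : Graph n) (C I : Subset n) (π : Rel n) (A : Subset n)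
              (k : ℕ) (Cs Is : Fin k → Subset n) : Set where
  field
    N1 : ∀ x y → y ∈ C → strict π x y → x ∈ C ⊎ x ∈ A
    disjCC : ∀ i j x → i ≢ j → x ∈ Cs i → x ∉ Cs j
    disjII : ∀ i j x → i ≢ j → x ∈ Is i → x ∉ Is j
    disjCI : ∀ i j x → x ∈ Cs i → x ∉ Is j
    unionA : ∀ x → x ∈ A → ∃[ j ] x ∈ Is j
    unionA' : ∀ x j → x ∈ Is j → x ∈ A
    N2 : ∀ i x → x ∈ Is i → ∀ y → (Adj G x y → ∃[ j ] (j ≤ᶠ i × y ∈ Cs j))
                                × (∀ j → j ≤ᶠ i → y ∈ Cs j → Adj G x y)
    N3 : ∀ i x y → (y ∈ Cs i ⊎ y ∈ Is i) → strict π x y →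
         ∃[ j ] (j ≤ᶠ i × (x ∈ Cs j ⊎ x ∈ Is j))
    N4 : ∀ i x x' → x ∈ Is i → x' ∈ Is i →
         (∃[ y ] (y ∈ Cs i × strict π x y)) →
         (∃[ y ] (y ∈ Cs i × strict π x' y)) → x ≡ x'

data NGen {n} (C I : Subset n) (π : Rel n) (A : Subset n)
          {k : ℕ} (Cs Is : Fin k → Subset n) : Rel n where
  P1 : ∀ {x y} → strict π x y → NGen C I π A Cs Is x y
  P2 : ∀ {x y} i → (x ∈ Is i ⊎ x ∈ Cs i) →
       (∀ j → j ≤ᶠ i → y ∉ Is j × y ∉ Cs j) → NGen C I π A Cs Is x y
  P3 : ∀ {x y} → x ∈ C → y ∈ I → y ∉ A → NGen C I π A Cs Is x y
  P4 : ∀ {x y} i → x ∈ Is i → y ∈ Is i →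
       (∃[ z ] (z ∈ Cs i × strict π x z)) → NGen C I π A Cs Is x y

nestedPO : ∀ {n} (C I : Subset n) (π : Rel n) (A : Subset n)
           {k : ℕ} (Cs Is : Fin k → Subset n) → Rel n
nestedPO C I π A Cs Is = Star (NGen C I π A Cs Is)

-- Label search.  Positions are 0-based (Fin n) instead of 1-based; this is
-- immaterial for all three label orders below.

data Search : Set where
  MNS MCS LBFS : Search

Label : ℕ → Set
Label n = Subset n

IsMin : ∀ {n} → Subset n → Fin n → Set
IsMin S m = m ∈ S × (∀ j → j ∈ S → toℕ m ≤ toℕ j)

_≺L[_]_ : ∀ {n} → Label n → Search → Label n → Set
L ≺L[ MNS ] M = L ⊂ M
L ≺L[ MCS ] M = ∣ L ∣ < ∣ M ∣
L ≺L[ LBFS ] M = L ⊂ M ⊎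
  (∃[ a ] ∃[ b ] (IsMin (L ─ M) a × IsMin (M ─ L) b × toℕ b < toℕ a))

-- label of vertex x at the beginning of step i (i.e. after numbering the
-- vertices at positions < i): the set of positions j < i with σ(j) ∈ N(x).
label : ∀ {n} → Graph n → Ordering n → Fin n → Fin n → Label n
label G σ i x = tabulate λ j → (toℕ j <ᵇ toℕ i) ∧ adj G (at σ j) x

Unnumbered : ∀ {n} → Ordering n → Fin n → Fin n → Set
Unnumbered σ i x = toℕ i ≤ toℕ (pos σ x)

Eligible : ∀ {n} → Graph n → Search → Ordering n → Fin n → Fin n → Set
Eligible G 𝒜 σ i x = Unnumbered σ i x ×
  ¬ (∃[ y ] (Unnumbered σ i y × label G σ i x ≺L[ 𝒜 ] label G σ i y))

IsPlusSearch : ∀ {n} → Graph n → Search → Ordering n → Ordering n → Set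
IsPlusSearch G 𝒜 ρ σ = ∀ i → Eligible G 𝒜 σ i (at σ i) ×
  (∀ x → Eligible G 𝒜 σ i x → toℕ (pos ρ (at σ i)) ≤ toℕ (pos ρ x))

-- Induction on the position of y in σ.  If x ∈ A ∪ C precedes y in π^N but
-- is still unnumbered when y is chosen, then x is left of y in ρ, so x must
-- have been ineligible: some numbered v is adjacent to an unnumbered z but
-- not to x.  Using the nested neighbourhoods of the sets I_j, every such
-- configuration yields an edge of π^N either from y back to x, contradicting
-- acyclicity of π^N, or from x (or from a C-vertex still unnumbered) to the
-- already numbered v, contradicting the induction hypothesis.  The three
-- searches enter only through two properties of their label orders: a proper
-- inclusion L ⊂ M gives L ≺ M, and L ≺ M forces an element of M ∖ L.
module Submission where

open import Defs
open import Data.Nat using (ℕ)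
open import Data.Fin using (Fin)
open import Data.Fin.Subset using (Subset; _⊆_; _∉_)
open import Data.Product using (_×_)
open import Data.Sum using (_⊎_)

open import Data.Bool using (Bool; true; _∧_) renaming (_≟_ to _≟ᵇ_)
open import Data.Bool.Properties using (∧-conicalˡ; ∧-conicalʳ; T-≡)
open import Data.Empty using (⊥-elim)
open import Data.Fin using (zero; suc; toℕ; _≟_; _≤?_)
open import Data.Fin.Properties using (any?; _<?_; <-irrefl; ≤-antisym; ≤∧≢⇒<)
open import Data.Fin.Subset using (_∈_; _⊂_; _─_; inside; outside)
open import Data.Fin.Subset.Properties using (_∈?_; p─q⊆p; p⊆q⇒∣p∣≤∣q∣; p⊂q⇒∣p∣<∣q∣)
open import Data.Nat using (_<_; _≤_; _<ᵇ_)
open import Data.Nat.Induction using (<-wellFounded)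
import Data.Nat.Properties as ℕ
open import Data.Product using (∃-syntax; _,_; proj₁; proj₂)
open import Data.Sum using (inj₁; inj₂; [_,_])
open import Data.Vec using (_∷_; there; tabulate)
open import Data.Vec.Properties using ([]=⇒lookup; lookup⇒[]=; lookup∘tabulate)
open import Function using (_∘_)
open import Function.Bundles using (Inverse; Equivalence)
open import Induction.WellFounded using (module All)
open import Relation.Binary.Construct.Closure.ReflexiveTransitive using (Star; ε; _◅_)
import Relation.Binary.Construct.On as On
open import Relation.Binary.PropositionalEquality using (_≡_; _≢_; refl; sym; trans; cong₂; subst; ≢-sym)
open import Relation.Binary.Structures using (IsPartialOrder)
open import Relation.Nullary using (¬_; yes; no)
open import Relation.Nullary.Decidable using (_×-dec_; _⊎-dec_; ¬?)

x∈p─q⇒x∉q : ∀ {n} {p q : Subset n} {x} → x ∈ p ─ q → x ∉ q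
x∈p─q⇒x∉q {p = _ ∷ _} {inside  ∷ _} {zero}  ()
x∈p─q⇒x∉q {p = _ ∷ _} {outside ∷ _} {zero}  _      ()
x∈p─q⇒x∉q {p = _ ∷ _} {_       ∷ _} {suc x} (there x∈p─q) (there x∈q) =
  x∈p─q⇒x∉q x∈p─q x∈q

∈-tabulate⁻ : ∀ {n} (f : Fin n → Bool) {j} → j ∈ tabulate f → f j ≡ true
∈-tabulate⁻ f {j} j∈ = trans (sym (lookup∘tabulate f j)) ([]=⇒lookup j∈)

∈-tabulate⁺ : ∀ {n} (f : Fin n → Bool) {j} → f j ≡ true → j ∈ tabulate f
∈-tabulate⁺ f {j} fj = lookup⇒[]= j (tabulate f) (trans (lookup∘tabulate f j) fj)

≺L⇒∃∈∖ : ∀ 𝒜 {n} {L M : Label n} → L ≺L[ 𝒜 ] M → ∃[ j ] (j ∈ M × j ∉ L)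
≺L⇒∃∈∖ MNS (_ , new) = new
≺L⇒∃∈∖ LBFS (inj₁ (_ , new)) = new
≺L⇒∃∈∖ LBFS {L = L} {M} (inj₂ (_ , b , _ , (b∈M─L , _) , _)) =
  b , p─q⊆p M L b∈M─L , x∈p─q⇒x∉q b∈M─L
≺L⇒∃∈∖ MCS {L = L} {M} ∣L∣<∣M∣ with any? (λ j → (j ∈? M) ×-dec ¬? (j ∈? L))
... | yes new = new
... | no ¬new = ⊥-elim (ℕ.<⇒≱ ∣L∣<∣M∣ (p⊆q⇒∣p∣≤∣q∣ M⊆L))
  where
  M⊆L : M ⊆ L
  M⊆L {j} j∈M with j ∈? L
  ... | yes j∈L = j∈L
  ... | no j∉L = ⊥-elim (¬new (j , j∈M , j∉L))

⊂⇒≺L : ∀ 𝒜 {n} {L M : Label n} → L ⊂ M → L ≺L[ 𝒜 ] M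
⊂⇒≺L MNS  L⊂M = L⊂M
⊂⇒≺L MCS  L⊂M = p⊂q⇒∣p∣<∣q∣ L⊂M
⊂⇒≺L LBFS L⊂M = inj₁ L⊂M

Numbered : ∀ {n} → Ordering n → Fin n → Fin n → Set
Numbered σ t v = toℕ (pos σ v) < toℕ t

pos-at : ∀ {n} (σ : Ordering n) j → pos σ (at σ j) ≡ j
pos-at σ = Inverse.strictlyInverseʳ σ

at-pos : ∀ {n} (σ : Ordering n) v → at σ (pos σ v) ≡ v
at-pos σ = Inverse.strictlyInverseˡ σ

Saturated : ∀ {n} → Graph n → Ordering n → Fin n → Fin n → Set
Saturated G σ t x = ∀ {v z} → Numbered σ t v → Unnumbered σ t z → Adj G v z → ¬ ¬ Adj G v x

module _ {n} (G : Graph n) (σ : Ordering n) where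

  ∈-label⁻ : ∀ {t x j} → j ∈ label G σ t x → Numbered σ t (at σ j) × Adj G (at σ j) x
  ∈-label⁻ {t} {x} {j} j∈ =
    subst (λ i → toℕ i < toℕ t) (sym (pos-at σ j))
          (ℕ.<ᵇ⇒< _ _ (Equivalence.from T-≡ (∧-conicalˡ _ _ labelled)))
    , ∧-conicalʳ _ _ labelled
    where
    labelled : ((toℕ j <ᵇ toℕ t) ∧ adj G (at σ j) x) ≡ true
    labelled = ∈-tabulate⁻ _ j∈

  ∈-label⁺ : ∀ {t x v} → Numbered σ t v → Adj G v x → pos σ v ∈ label G σ t x
  ∈-label⁺ {t} {x} {v} vN vx =
    ∈-tabulate⁺ _ (cong₂ _∧_ (Equivalence.to T-≡ (ℕ.<⇒<ᵇ vN))
                             (subst (λ u → Adj G u x) (sym (at-pos σ v)) vx))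

  saturated⇒eligible : ∀ 𝒜 {t x} → Unnumbered σ t x → Saturated G σ t x → Eligible G 𝒜 σ t x
  saturated⇒eligible 𝒜 {t} {x} xU sat = xU , λ (z , zU , x≺z) →
    let (j , j∈z , j∉x) = ≺L⇒∃∈∖ 𝒜 x≺z
        (vN , vz)       = ∈-label⁻ j∈z
    in sat vN zU vz (λ vx → j∉x (subst (_∈ label G σ t x) (pos-at σ j) (∈-label⁺ vN vx)))

module PlusSearch {n} (G : Graph n) (𝒜 : Search) (ρ σ : Ordering n)
                  (search : IsPlusSearch G 𝒜 ρ σ) where

  chosen-eligible : ∀ y → Eligible G 𝒜 σ (pos σ y) y
  chosen-eligible y = subst (Eligible G 𝒜 σ (pos σ y)) (at-pos σ y) (proj₁ (search (pos σ y)))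

  chosen-leftmost : ∀ y x → Eligible G 𝒜 σ (pos σ y) x → toℕ (pos ρ y) ≤ toℕ (pos ρ x)
  chosen-leftmost y x x-eligible = subst (λ u → toℕ (pos ρ u) ≤ toℕ (pos ρ x)) (at-pos σ y)
                                         (proj₂ (search (pos σ y)) x x-eligible)

  chosen-label-maximal : ∀ {y z v} → Unnumbered σ (pos σ y) z →
    (∀ {u} → Numbered σ (pos σ y) u → Adj G u y → Adj G u z) →
    Numbered σ (pos σ y) v → Adj G v z → ¬ ¬ Adj G v y
  chosen-label-maximal {y} {z} {v} zU covered vN vz ¬vy =
    proj₂ (chosen-eligible y)
          (z , zU , ⊂⇒≺L 𝒜 (label-y⊆label-z , pos σ v , ∈-label⁺ G σ vN vz , v∉label-y))
    where
    label-y⊆label-z : label G σ (pos σ y) y ⊆ label G σ (pos σ y) z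
    label-y⊆label-z {j} j∈y =
      let (uN , uy) = ∈-label⁻ G σ j∈y
      in subst (_∈ label G σ (pos σ y) z) (pos-at σ j) (∈-label⁺ G σ uN (covered uN uy))
    v∉label-y : pos σ v ∉ label G σ (pos σ y) y
    v∉label-y v∈y =
      ¬vy (subst (λ u → Adj G u y) (at-pos σ v) (proj₂ (∈-label⁻ G σ {pos σ y} v∈y)))

module NestedOrder {n} {G : Graph n} {C I : Subset n} (split : IsSplitPartition G C I)
                   {π : Rel n} (po : IsPO π) {A : Subset n} (A⊆I : A ⊆ I)
                   {k : ℕ} {Cs Is : Fin k → Subset n} (nested : Nested G C I π A k Cs Is)
                   (ρ : Ordering n) (ext : IsLinearExtension (nestedPO C I π A Cs Is) ρ) where

  open IsSplitPartition split
  open Nested nested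

  private
    variable
      i j m m′ : Fin k
      u v x y z : Fin n

  _⟶_ : Rel n
  _⟶_ = NGen C I π A Cs Is

  _≺ᴺ_ : Rel n
  _≺ᴺ_ = strict (nestedPO C I π A Cs Is)

  ⟶⇒≺ᴺ : x ⟶ y → x ≢ y → x ≺ᴺ y
  ⟶⇒≺ᴺ x⟶y x≢y = x⟶y ◅ ε , x≢y

  ≺ᴺ-asym : x ≺ᴺ y → ¬ y ≺ᴺ x
  ≺ᴺ-asym {x} {y} x≺y y≺x = ℕ.<-asym (ext x y x≺y) (ext y x y≺x)

  ≺ᴺ⇒¬⟶ : x ≺ᴺ y → ¬ y ⟶ x
  ≺ᴺ⇒¬⟶ x≺y y⟶x = ≺ᴺ-asym x≺y (⟶⇒≺ᴺ y⟶x (≢-sym (proj₂ x≺y)))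

  adj-sym : Adj G x y → Adj G y x
  adj-sym {x} {y} xy = trans (symmetric G y x) xy

  I-neighbour∈C : x ∈ I → Adj G x y → y ∈ C
  I-neighbour∈C {x} {y} xI xy with cover y
  ... | inj₁ yC = yC
  ... | inj₂ yI = ⊥-elim (independent x y xI yI xy)

  Is⊆I : x ∈ Is i → x ∈ I
  Is⊆I {x} {i} xIs = A⊆I (unionA' x i xIs)

  Is-level-unique : x ∈ Is i → x ∈ Is j → i ≡ j
  Is-level-unique {x} {i} {j} xi xj with i ≟ j
  ... | yes i≡j = i≡j
  ... | no i≢j = ⊥-elim (disjII i j x i≢j xi xj)

  Beyond : Fin k → Fin n → Set
  Beyond i y = ∀ j → j ≤ᶠ i → y ∉ Is j × y ∉ Cs j

  Is-beyond : x ∈ Is m → toℕ i < toℕ m → Beyond i x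
  Is-beyond {x} {m} xm i<m j j≤i =
    (λ xj → <-irrefl (Is-level-unique xj xm) (ℕ.≤-<-trans j≤i i<m))
    , λ xCj → disjCI j m x xCj xm

  C-beyond : x ∈ C → (∀ j → j ≤ᶠ i → x ∉ Cs j) → Beyond i x
  C-beyond xC x∉Cs j j≤i = (λ xIs → disjoint _ xC (Is⊆I xIs)) , x∉Cs j j≤i

  Is-neighbourhoods-nested : u ∈ Is m′ → v ∈ Is m → Adj G u y → ¬ Adj G v y →
                             Adj G v z → Adj G u z
  Is-neighbourhoods-nested {u} {m′} {v} {m} {y} {z} uIs vIs uy ¬vy vz
    with proj₁ (N2 m′ u uIs y) uy | proj₁ (N2 m v vIs z) vz
  ... | j , j≤m′ , yCj | l , l≤m , zCl with j ≤? m
  ...   | yes j≤m = ⊥-elim (¬vy (proj₂ (N2 m v vIs y) j j≤m yCj))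
  ...   | no j≰m =
    proj₂ (N2 m′ u uIs z) l (ℕ.≤-trans l≤m (ℕ.≤-trans (ℕ.<⇒≤ (ℕ.≰⇒> j≰m)) j≤m′)) zCl

  BelowCs : Fin k → Fin n → Set
  BelowCs i x = ∃[ z ] (z ∈ Cs i × strict π x z)

  beyond-¬reaches-Cs : Beyond i u → y ∈ Cs i → ¬ Star _⟶_ u y
  beyond-¬reaches-Cs {i} {u} beyond yC u⟶⋆y =
    ≺ᴺ⇒¬⟶ (u⟶⋆y , λ { refl → proj₂ (beyond i ℕ.≤-refl) yC }) (P2 i (inj₂ yC) beyond)

  reaches-Cs⇒BelowCs : u ∈ Is i → y ∈ Cs i → Star _⟶_ u y → BelowCs i u
  reaches-Cs⇒BelowCs {u} {i} uIs yC ε = ⊥-elim (disjCI i i u yC uIs)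
  reaches-Cs⇒BelowCs uIs yC (P2 _ (inj₁ uIs′) beyond ◅ w⟶⋆y)
    with refl ← Is-level-unique uIs′ uIs = ⊥-elim (beyond-¬reaches-Cs beyond yC w⟶⋆y)
  reaches-Cs⇒BelowCs {u} {i} uIs yC (P2 i′ (inj₂ uC) _ ◅ _) = ⊥-elim (disjCI i′ i u uC uIs)
  reaches-Cs⇒BelowCs uIs yC (P3 uC _ _ ◅ _) = ⊥-elim (disjoint _ uC (Is⊆I uIs))
  reaches-Cs⇒BelowCs uIs yC (P4 _ uIs′ _ below ◅ _)
    with refl ← Is-level-unique uIs′ uIs = below
  reaches-Cs⇒BelowCs {u} {i} uIs yC (P1 {y = w} u≺w ◅ w⟶⋆y) with w ∈? Cs i | w ∈? Is i
  ... | yes wC | _ = w , wC , u≺w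
  ... | no _ | yes wIs =
    let (c , cC , w≤c , _) = reaches-Cs⇒BelowCs wIs yC w⟶⋆y
    in c , cC , IsPartialOrder.trans po (proj₁ u≺w) w≤c , λ { refl → disjCI i i u cC uIs }
  ... | no w∉C | no w∉Is with any? (λ j → (j ≤? i) ×-dec ((w ∈? Is j) ⊎-dec (w ∈? Cs j)))
  ...   | no ¬below = ⊥-elim (beyond-¬reaches-Cs beyond yC w⟶⋆y)
    where
    beyond : Beyond i w
    beyond j j≤i = (λ wIs → ¬below (j , j≤i , inj₁ wIs)) , (λ wC → ¬below (j , j≤i , inj₂ wC))
  ...   | yes (j , j≤i , wj) =
    ⊥-elim (≺ᴺ⇒¬⟶ (⟶⇒≺ᴺ (P1 u≺w) (proj₂ u≺w)) (P2 j wj (Is-beyond uIs j<i)))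
    where
    j<i : toℕ j < toℕ i
    j<i = ≤∧≢⇒< j≤i λ { refl → [ w∉Is , w∉C ] wj }

  source-in-A∪C : x ≺ᴺ y → y ∈ A ⊎ y ∈ C → x ∈ A ⊎ x ∈ C
  source-in-A∪C {x} {y} x≺y yAC with cover x
  ... | inj₁ xC = inj₂ xC
  ... | inj₂ xI with x ∈? A
  ...   | yes xA = inj₁ xA
  ...   | no x∉A = ⊥-elim (≺ᴺ⇒¬⟶ x≺y (y⟶x yAC))
    where
    y⟶x : y ∈ A ⊎ y ∈ C → y ⟶ x
    y⟶x (inj₂ yC) = P3 yC xI x∉A
    y⟶x (inj₁ yA) with unionA y yA
    ... | m , yIs = P2 m (inj₁ yIs) λ j j≤m →
      (λ xIs → x∉A (unionA' x j xIs)) ,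
      (λ xCj → independent y x (Is⊆I yIs) xI (proj₂ (N2 m y yIs x) j j≤m xCj))

  module _ (𝒜 : Search) (σ : Ordering n) (search : IsPlusSearch G 𝒜 ρ σ) where

    open PlusSearch G 𝒜 ρ σ search

    Precedes : Fin n → Set
    Precedes y = ∀ {x} → x ∈ A ⊎ x ∈ C → x ≺ᴺ y → x ≺[ σ ] y

    module InductiveStep (y : Fin n) (IH : ∀ {b} → Numbered σ (pos σ y) b → Precedes b) where

      Numbered′ Unnumbered′ : Fin n → Set
      Numbered′ = Numbered σ (pos σ y)
      Unnumbered′ = Unnumbered σ (pos σ y)

      numbered≢unnumbered : Numbered′ v → Unnumbered′ x → v ≢ x
      numbered≢unnumbered vN xU refl = ℕ.<⇒≱ vN xU

      ¬⟶numbered : x ∈ A ⊎ x ∈ C → Unnumbered′ x → Numbered′ v → ¬ x ⟶ v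
      ¬⟶numbered xAC xU vN x⟶v =
        ℕ.<⇒≱ (ℕ.<-trans (IH vN xAC (⟶⇒≺ᴺ x⟶v (≢-sym (numbered≢unnumbered vN xU)))) vN) xU

      -- A vertex u ∈ I ∖ A would give the edge z ⟶ u of (P3).
      numbered-I⊆A : z ∈ C → Unnumbered′ z → Numbered′ u → u ∈ I → ∃[ m ] u ∈ Is m
      numbered-I⊆A {z} {u} zC zU uN uI with u ∈? A
      ... | yes uA = unionA u uA
      ... | no u∉A = ⊥-elim (¬⟶numbered (inj₂ zC) zU uN (P3 zC uI u∉A))

      -- Otherwise label(y) ⊊ label(z) and y would not have been eligible.
      adjacent-to-chosen : v ∈ Is m → Numbered′ v → Unnumbered′ z → Adj G v z → Adj G v y
      adjacent-to-chosen {v} {m} {z} vIs vN zU vz with adj G v y ≟ᵇ true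
      ... | yes vy = vy
      ... | no ¬vy = ⊥-elim (chosen-label-maximal zU covered vN vz ¬vy)
        where
        zC : z ∈ C
        zC = I-neighbour∈C (Is⊆I vIs) vz
        covered : ∀ {u} → Numbered′ u → Adj G u y → Adj G u z
        covered {u} uN uy with cover u
        ... | inj₁ uC = clique u z uC zC (numbered≢unnumbered uN zU)
        ... | inj₂ uI with numbered-I⊆A zC zU uN uI
        ...   | _ , uIs = Is-neighbourhoods-nested uIs vIs uy ¬vy vz

      C-saturated : x ∈ C → Unnumbered′ x → x ≺ᴺ y → Saturated G σ (pos σ y) x
      C-saturated {x} xC xU x≺y {v} {z} vN zU vz ¬vx with cover v
      ... | inj₁ vC = ¬vx (clique v x vC xC (numbered≢unnumbered vN xU))
      ... | inj₂ vI with numbered-I⊆A xC xU vN vI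
      ...   | i , vIs with proj₁ (N2 i v vIs y) (adjacent-to-chosen vIs vN zU vz)
      ...     | j , j≤i , yCj = ≺ᴺ⇒¬⟶ x≺y (P2 j (inj₂ yCj) (C-beyond xC x∉Cs))
        where
        x∉Cs : ∀ l → l ≤ᶠ j → x ∉ Cs l
        x∉Cs l l≤j xCl = ¬vx (proj₂ (N2 i v vIs x) l (ℕ.≤-trans l≤j j≤i) xCl)

      Is-saturated : x ∈ Is i → Unnumbered′ x → x ≺ᴺ y → Saturated G σ (pos σ y) x
      Is-saturated {x} {i} xIs xU x≺y {v} {z} vN zU vz ¬vx with cover v
      ... | inj₁ vC =
        ¬⟶numbered (inj₁ (unionA' x i xIs)) xU vN (P2 i (inj₁ xIs) (C-beyond vC v∉Cs))
        where
        v∉Cs : ∀ l → l ≤ᶠ i → v ∉ Cs l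
        v∉Cs l l≤i vCl = ¬vx (adj-sym (proj₂ (N2 i x xIs v) l l≤i vCl))
      ... | inj₂ vI with numbered-I⊆A (I-neighbour∈C vI vz) zU vN vI
      ...   | m , vIs with proj₁ (N2 m v vIs y) (adjacent-to-chosen vIs vN zU vz)
      ...     | j , j≤m , yCj with i <? m | j <? i
      ...       | yes i<m | _ =
        ¬⟶numbered (inj₁ (unionA' x i xIs)) xU vN (P2 i (inj₁ xIs) (Is-beyond vIs i<m))
      ...       | no _ | yes j<i = ≺ᴺ⇒¬⟶ x≺y (P2 j (inj₂ yCj) (Is-beyond xIs j<i))
      ...       | no i≮m | no j≮i
        with refl ← ≤-antisym (ℕ.≮⇒≥ i≮m) (ℕ.≤-trans (ℕ.≮⇒≥ j≮i) j≤m)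
        with refl ← ≤-antisym j≤m (ℕ.≮⇒≥ j≮i) =
          ¬⟶numbered (inj₁ (unionA' x i xIs)) xU vN
                     (P4 i xIs vIs (reaches-Cs⇒BelowCs xIs yCj (proj₁ x≺y)))

      saturated : x ∈ A ⊎ x ∈ C → Unnumbered′ x → x ≺ᴺ y → Saturated G σ (pos σ y) x
      saturated {x} (inj₁ xA) with unionA x xA
      ... | _ , xIs = Is-saturated xIs
      saturated (inj₂ xC) = C-saturated xC

      precedes : Precedes y
      precedes {x} xAC x≺y with pos σ x <? pos σ y
      ... | yes x<y = x<y
      ... | no x≮y = ⊥-elim (ℕ.<⇒≱ (ext x y x≺y) (chosen-leftmost y x x-eligible))
        where
        xU : Unnumbered′ x
        xU = ℕ.≮⇒≥ x≮y
        x-eligible : Eligible G 𝒜 σ (pos σ y) x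
        x-eligible = saturated⇒eligible G σ 𝒜 xU (saturated xAC xU x≺y)

    precedes : ∀ y → Precedes y
    precedes = All.wfRec (On.wellFounded (λ v → toℕ (pos σ v)) <-wellFounded) _ Precedes
                         InductiveStep.precedes

    precedes-or-outside-A∪C : ∀ x y → x ≺ᴺ y →
                              x ≺[ σ ] y ⊎ ((x ∉ A × x ∉ C) × (y ∉ A × y ∉ C))
    precedes-or-outside-A∪C x y x≺y with (x ∈? A) ⊎-dec (x ∈? C) | (y ∈? A) ⊎-dec (y ∈? C)
    ... | yes xAC | _       = inj₁ (precedes y xAC x≺y)
    ... | no _    | yes yAC = inj₁ (precedes y (source-in-A∪C x≺y yAC) x≺y)
    ... | no x∉   | no y∉   = inj₂ ((x∉ ∘ inj₁ , x∉ ∘ inj₂) , (y∉ ∘ inj₁ , y∉ ∘ inj₂))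

lemma7 : ∀ {n} (G : Graph n) (C I : Subset n) → IsSplitPartition G C I →
         (π : Rel n) → IsPO π → (A : Subset n) → A ⊆ I →
         (k : ℕ) (Cs Is : Fin k → Subset n) → Nested G C I π A k Cs Is →
         (ρ : Ordering n) → IsLinearExtension (nestedPO C I π A Cs Is) ρ →
         (𝒜 : Search) (σ : Ordering n) → IsPlusSearch G 𝒜 ρ σ →
         ∀ x y → strict (nestedPO C I π A Cs Is) x y →
         x ≺[ σ ] y ⊎ ((x ∉ A × x ∉ C) × (y ∉ A × y ∉ C))
lemma7 G C I split π po A A⊆I k Cs Is nested ρ ext 𝒜 σ search =
  NestedOrder.precedes-or-outside-A∪C split po A⊆I nested ρ ext 𝒜 σ search
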